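{- Let $n\ge2$, $m$ and $s$ be positive integers, $a\in\mathbb{Z}/m\mathbb{Z}$ and $d=(d_1,\ldots,d_n)\in(\mathbb{Z}/m\mathbb{Z})^n$, and let $\triangle=\mathrm{AS}(a,d,s)$. Set $d_0:=0$. Then $$\mathfrak{m}_\triangle(x+d_j)-\mathfrak{m}_\triangle(x+d_i)=\mathfrak{m}_{\mathrm{F}_j(\triangle)}(x+d_j)-\mathfrak{m}_{\mathrm{F}_i(\triangle)}(x+d_i)$$ for all $x\in\mathbb{Z}/m\mathbb{Z}$ and all distinct integers $i,j\in[0,n]$.
   Context: $\mathrm{AS}(a,d,s)$ is the multiset $\{a+\sum_{u=1}^n l_ud_u: l\in\mathbb{N}^n,\ l_1+\cdots+l_n\le s-1\}$ of $\mathbb{Z}/m\mathbb{Z}$; $\mathfrak{m}_M(x)$ denotes the multiplicity of $x$ in a multiset $M$. Its facets are the multisets $\mathrm{F}_k(\triangle)=\{a+\sum_u l_ud_u: l\in\mathbb{N}^n,\ l_k=0,\ \sum_u l_u\le s-1\}$ for $k\in[1,n]$, and $\mathrm{F}_0(\triangle)=\{a+\sum_ul_ud_u: l\in\mathbb{N}^n,\ \sum_ul_u=s-1\}$. -}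

module Defs where

open import Data.Nat using (ℕ; zero; suc; _+_; _*_; _∸_; NonZero)
open import Data.Nat.DivMod using (_%_; m%n<n)
open import Data.Fin using (Fin; toℕ; fromℕ<) renaming (zero to fz; suc to fs)
import Data.Fin as Fin
open import Data.Vec using (Vec; []; _∷_; lookup)
open import Data.List using (List; []; _∷_; map; concatMap; upTo; filter; length)
open import Data.Product using (_×_)
open import Relation.Nullary using (Dec; yes; no)
open import Relation.Nullary.Decidable using (_×-dec_)
import Data.Nat as ℕ

-- Elements of ℤ/mℤ are represented by Fin m (m > 0); addition is mod m.
_⊕_ : {m : ℕ} .{{_ : NonZero m}} → Fin m → Fin m → Fin m
_⊕_ {m} x y = fromℕ< (m%n<n (toℕ x + toℕ y) m)

lin : {n m : ℕ} → Vec ℕ n → (Fin n → Fin m) → ℕ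
lin [] d = 0
lin (l ∷ ls) d = l * toℕ (d fz) + lin ls (λ u → d (fs u))

point : {n m : ℕ} .{{_ : NonZero m}} → Fin m → (Fin n → Fin m) → Vec ℕ n → Fin m
point {m = m} a d l = fromℕ< (m%n<n (toℕ a + lin l d) m)

vsum : {n : ℕ} → Vec ℕ n → ℕ
vsum [] = 0
vsum (x ∷ xs) = x + vsum xs

tuples : (n k : ℕ) → List (Vec ℕ n)
tuples zero k = [] ∷ []
tuples (suc n) k = concatMap (λ i → map (i ∷_) (tuples n (k ∸ i))) (upTo (suc k))

-- multiplicity of x in AS(a,d,s): #{l : Σ l ≤ s-1, a + Σ l_u d_u = x}
multAS : {n m : ℕ} .{{_ : NonZero m}} → Fin m → (Fin n → Fin m) → ℕ → Fin m → ℕ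
multAS {n} a d s x = length (filter (λ l → point a d l Fin.≟ x) (tuples n (s ∸ 1)))

-- multiplicity of x in the facet F_k(AS(a,d,s)), k ∈ [0,n] encoded as Fin (suc n):
--   k = 0      : Σ l = s-1
--   k = u ∈ [1,n] : l_u = 0
facetCond : {n : ℕ} → ℕ → Fin (suc n) → Vec ℕ n → Set
facetCond s fz l = vsum l ≡ s ∸ 1
  where open import Relation.Binary.PropositionalEquality using (_≡_)
facetCond s (fs u) l = lookup l u ≡ 0
  where open import Relation.Binary.PropositionalEquality using (_≡_)

facetCond? : {n : ℕ} → (s : ℕ) → (k : Fin (suc n)) → (l : Vec ℕ n) → Dec (facetCond s k l)
facetCond? s fz l = vsum l ℕ.≟ (s ∸ 1)
facetCond? s (fs u) l = lookup l u ℕ.≟ 0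

multF : {n m : ℕ} .{{_ : NonZero m}} → Fin (suc n) → Fin m → (Fin n → Fin m) → ℕ → Fin m → ℕ
multF {n} k a d s x =
  length (filter (λ l → facetCond? s k l ×-dec (point a d l Fin.≟ x)) (tuples n (s ∸ 1)))

dExt : {n m : ℕ} .{{_ : NonZero m}} → (Fin n → Fin m) → Fin (suc n) → Fin m
dExt {m = suc m} d fz = fz
dExt d (fs u) = d u

module Submission where

-- Split the points of △ = AS(a,d,s) according to whether they lie on the facet F_k.
-- Off F_0 lie the tuples with Σ l < s - 1, i.e. a copy of AS(a,d,s-1) (empty when s = 1).
-- Off F_u (u ≥ 1) lie the tuples with l_u ≥ 1, and l ↦ l - e_u maps them bijectively onto
-- the same tuples Σ l < s - 1 while translating each point by -d_u. Hence for every k ∈ [0,n]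
--   m_△(x + d_k) = m_{F_k(△)}(x + d_k) + m_{AS(a,d,s-1)}(x),
-- and the last term cancels in the difference.

open import Defs
open import Data.Nat using (ℕ; zero; suc; NonZero; _≥_; _+_; _*_; _∸_; _<_; _≤_)
import Data.Nat as ℕ
open import Data.Nat.Properties using (+-assoc; +-comm; +-identityʳ; +-suc; *-suc; ≤-pred; n∸n≡0; +-∸-assoc; m+n∸m≡n; m+[n∸m]≡n; m≤n⇒m≤1+n)
open import Data.Nat.DivMod using (_%_; %-congˡ; %-distribˡ-+; [m+kn]%n≡m%n; m<n⇒m%n≡m)
open import Data.Fin using (Fin; toℕ) renaming (zero to fz; suc to fs)
import Data.Fin as Fin
open import Data.Fin.Properties using (toℕ-fromℕ<; toℕ-injective; toℕ<n)
open import Data.Vec using (Vec; _∷_; lookup; replicate; _[_]%=_)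
open import Data.Vec.Properties using (lookup-replicate)
open import Data.List using (List; []; _∷_; _++_; [_]; map; concat; concatMap; upTo; applyUpTo; filter; length)
open import Data.List.Properties
  using (filter-++; filter-≐; filter-reject; filter-all; filter-none; map-cong-local; map-concatMap; map-∘;
         concatMap-cong; concatMap-map; concatMap-++; upTo-∷ʳ; map-upTo; length-map; ++-identityʳ)
open import Data.List.Relation.Unary.All using (universal)
open import Data.List.Relation.Unary.All.Properties using (applyUpTo⁺₁; map⁺)
open import Data.Product using (_,_)
import Data.Integer as ℤ
open import Data.Integer.Tactic.RingSolver using (solve-∀)
open import Function using (_∘_)
open import Relation.Nullary using (¬_; yes; no)
open import Relation.Nullary.Decidable using (_×-dec_)
open import Relation.Unary using (Pred; Decidable; ∁; _≐_)
open import Relation.Unary.Properties using (∁?)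
open import Relation.Binary.PropositionalEquality using (_≡_; _≢_; refl; sym; trans; cong; cong₂; module ≡-Reasoning)

module _ {a b p} {A : Set a} {B : Set b} {P : Pred B p} (P? : Decidable P) where

  filter-map : (f : A → B) (xs : List A) → filter P? (map f xs) ≡ map f (filter (P? ∘ f) xs)
  filter-map f [] = refl
  filter-map f (x ∷ xs) with P? (f x)
  ... | yes _ = cong (f x ∷_) (filter-map f xs)
  ... | no _ = filter-map f xs

  filter-concatMap : (f : A → List B) (xs : List A) →
    filter P? (concatMap f xs) ≡ concatMap (filter P? ∘ f) xs
  filter-concatMap f [] = refl
  filter-concatMap f (x ∷ xs) =
    trans (filter-++ P? (f x) (concatMap f xs)) (cong (filter P? (f x) ++_) (filter-concatMap f xs))

module _ {a p q} {A : Set a} {P : Pred A p} {Q : Pred A q} (Q? : Decidable Q) (P? : Decidable P) where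

  length-filter-split : (xs : List A) →
    length (filter P? xs) ≡ length (filter (λ x → Q? x ×-dec P? x) xs) + length (filter P? (filter (∁? Q?) xs))
  length-filter-split [] = refl
  length-filter-split (x ∷ xs) with Q? x
  ... | yes _ with P? x
  ...   | yes _ = cong suc (length-filter-split xs)
  ...   | no _ = length-filter-split xs
  length-filter-split (x ∷ xs) | no _ with P? x
  ...   | yes _ = trans (cong suc (length-filter-split xs)) (sym (+-suc _ _))
  ...   | no _ = length-filter-split xs

∁-resp-≐ : ∀ {a p q} {A : Set a} {P : Pred A p} {Q : Pred A q} → P ≐ Q → ∁ P ≐ ∁ Q
∁-resp-≐ (P⊆Q , Q⊆P) = (λ ¬p q → ¬p (Q⊆P q)) , (λ ¬q p → ¬q (P⊆Q p))

concatMap-upTo-cong : ∀ {b} {B : Set b} {f g : ℕ → List B} N →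
  (∀ {i} → i < N → f i ≡ g i) → concatMap f (upTo N) ≡ concatMap g (upTo N)
concatMap-upTo-cong N f≡g = cong concat (map-cong-local (applyUpTo⁺₁ _ N f≡g))

tuples-zero : ∀ n → tuples n 0 ≡ replicate n 0 ∷ []
tuples-zero zero = refl
tuples-zero (suc n) rewrite tuples-zero n = refl

vsum-replicate-zero : ∀ n → vsum (replicate n 0) ≡ 0
vsum-replicate-zero zero = refl
vsum-replicate-zero (suc n) = vsum-replicate-zero n

map-tuples-suc : ∀ {b} {B : Set b} n k (f : Vec ℕ (suc n) → B) →
  map f (tuples (suc n) k) ≡ concatMap (λ i → map (f ∘ (i ∷_)) (tuples n (k ∸ i))) (upTo (suc k))
map-tuples-suc n k f =
  trans (map-concatMap f _ (upTo (suc k))) (concatMap-cong (λ i → sym (map-∘ (tuples n (k ∸ i)))) (upTo (suc k)))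

-- The last block of tuples (suc n) (suc k) consists of the single tuple (suc k, 0, …, 0).
filter-tuples-suc : ∀ {p} n k {P : Pred (Vec ℕ (suc n)) p} (P? : Decidable P) (f : ℕ → List (Vec ℕ n)) →
  (∀ {i} → i ≤ k → filter P? (map (i ∷_) (tuples n (suc k ∸ i))) ≡ map (i ∷_) (f i)) →
  ¬ P (suc k ∷ replicate n 0) →
  filter P? (tuples (suc n) (suc k)) ≡ concatMap (λ i → map (i ∷_) (f i)) (upTo (suc k))
filter-tuples-suc n k P? f lower ¬top = begin
    filter P? (concatMap block (upTo (suc (suc k))))
  ≡⟨ filter-concatMap P? block (upTo (suc (suc k))) ⟩
    concatMap (filter P? ∘ block) (upTo (suc (suc k)))
  ≡⟨ cong (concatMap (filter P? ∘ block)) (sym (upTo-∷ʳ (suc k))) ⟩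
    concatMap (filter P? ∘ block) (upTo (suc k) ++ [ suc k ])
  ≡⟨ concatMap-++ (filter P? ∘ block) (upTo (suc k)) [ suc k ] ⟩
    concatMap (filter P? ∘ block) (upTo (suc k)) ++ filter P? (block (suc k)) ++ []
  ≡⟨ cong₂ _++_ (concatMap-upTo-cong (suc k) (lower ∘ ≤-pred)) (cong (_++ []) top) ⟩
    concatMap (λ i → map (i ∷_) (f i)) (upTo (suc k)) ++ []
  ≡⟨ ++-identityʳ _ ⟩
    concatMap (λ i → map (i ∷_) (f i)) (upTo (suc k)) ∎
  where
  open ≡-Reasoning
  block : ℕ → List (Vec ℕ (suc n))
  block i = map (i ∷_) (tuples n (suc k ∸ i))
  top : filter P? (block (suc k)) ≡ []
  top rewrite n∸n≡0 k | tuples-zero n = filter-reject P? ¬top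

tuples-below : ∀ n k → filter (∁? (λ l → vsum l ℕ.≟ suc k)) (tuples n (suc k)) ≡ tuples n k
tuples-below zero k = refl
tuples-below (suc n) k = filter-tuples-suc n k _ (λ i → tuples n (k ∸ i)) lower
  (λ ¬top → ¬top (trans (cong (suc k +_) (vsum-replicate-zero n)) (+-identityʳ (suc k))))
  where
  open ≡-Reasoning
  Below : ∀ {m} k' → Decidable (λ (t : Vec ℕ m) → ¬ vsum t ≡ k')
  Below k' = ∁? (λ t → vsum t ℕ.≟ k')
  lower : ∀ {i} → i ≤ k →
    filter (Below (suc k)) (map (i ∷_) (tuples n (suc k ∸ i))) ≡ map (i ∷_) (tuples n (k ∸ i))
  lower {i} i≤k = begin
      filter (Below (suc k)) (map (i ∷_) (tuples n (suc k ∸ i)))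
    ≡⟨ filter-map (Below (suc k)) (i ∷_) (tuples n (suc k ∸ i)) ⟩
      map (i ∷_) (filter (Below (suc k) ∘ (i ∷_)) (tuples n (suc k ∸ i)))
    ≡⟨ cong (map (i ∷_)) (filter-≐ (Below (suc k) ∘ (i ∷_)) (Below (suc k ∸ i)) head-≐ (tuples n (suc k ∸ i))) ⟩
      map (i ∷_) (filter (Below (suc k ∸ i)) (tuples n (suc k ∸ i)))
    ≡⟨ cong (λ k' → map (i ∷_) (filter (Below k') (tuples n k'))) (+-∸-assoc 1 i≤k) ⟩
      map (i ∷_) (filter (Below (suc (k ∸ i))) (tuples n (suc (k ∸ i))))
    ≡⟨ cong (map (i ∷_)) (tuples-below n (k ∸ i)) ⟩
      map (i ∷_) (tuples n (k ∸ i)) ∎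
    where
    drop-head : ∀ {t} → i + vsum t ≡ suc k → vsum t ≡ suc k ∸ i
    drop-head {t} e = trans (sym (m+n∸m≡n i (vsum t))) (cong (_∸ i) e)
    add-head : ∀ {t} → vsum t ≡ suc k ∸ i → i + vsum t ≡ suc k
    add-head {t} e = trans (cong (i +_) e) (m+[n∸m]≡n (m≤n⇒m≤1+n i≤k))
    head-≐ : (λ t → ¬ i + vsum t ≡ suc k) ≐ (λ t → ¬ vsum t ≡ suc k ∸ i)
    head-≐ = ∁-resp-≐ ((λ {t} → drop-head {t}) , (λ {t} → add-head {t}))

tuples-shift : ∀ n k (u : Fin n) →
  filter (∁? (λ l → lookup l u ℕ.≟ 0)) (tuples n (suc k)) ≡ map (_[ u ]%= suc) (tuples n k)
tuples-shift (suc n) k fz = begin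
    filter Pos (concatMap block (upTo (suc (suc k))))
  ≡⟨ filter-concatMap Pos block (upTo (suc (suc k))) ⟩
    filter Pos (block 0) ++ concatMap (filter Pos ∘ block) (applyUpTo suc (suc k))
  ≡⟨ cong₂ _++_ (filter-none Pos (map⁺ {f = 0 ∷_} (universal (λ _ ¬0≡0 → ¬0≡0 refl) (tuples n (suc k)))))
                (cong (concatMap (filter Pos ∘ block)) (sym (map-upTo suc (suc k)))) ⟩
    concatMap (filter Pos ∘ block) (map suc (upTo (suc k)))
  ≡⟨ concatMap-map (filter Pos ∘ block) suc (upTo (suc k)) ⟩
    concatMap (filter Pos ∘ block ∘ suc) (upTo (suc k))
  ≡⟨ concatMap-cong (λ i → filter-all Pos (map⁺ {f = suc i ∷_} (universal (λ _ ()) (tuples n (k ∸ i))))) (upTo (suc k)) ⟩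
    concatMap (block ∘ suc) (upTo (suc k))
  ≡⟨ sym (map-tuples-suc n k (_[ fz ]%= suc)) ⟩
    map (_[ fz ]%= suc) (tuples (suc n) k) ∎
  where
  open ≡-Reasoning
  Pos : Decidable (λ (l : Vec ℕ (suc n)) → ¬ lookup l fz ≡ 0)
  Pos = ∁? (λ l → lookup l fz ℕ.≟ 0)
  block : ℕ → List (Vec ℕ (suc n))
  block i = map (i ∷_) (tuples n (suc k ∸ i))
tuples-shift (suc n) k (fs u) = begin
    filter (∁? (λ l → lookup l (fs u) ℕ.≟ 0)) (tuples (suc n) (suc k))
  ≡⟨ filter-tuples-suc n k _ (λ i → map (_[ u ]%= suc) (tuples n (k ∸ i))) lower
       (λ ¬top → ¬top (lookup-replicate u 0)) ⟩
    concatMap (λ i → map (i ∷_) (map (_[ u ]%= suc) (tuples n (k ∸ i)))) (upTo (suc k))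
  ≡⟨ concatMap-cong (λ i → sym (map-∘ (tuples n (k ∸ i)))) (upTo (suc k)) ⟩
    concatMap (λ i → map ((_[ fs u ]%= suc) ∘ (i ∷_)) (tuples n (k ∸ i))) (upTo (suc k))
  ≡⟨ sym (map-tuples-suc n k (_[ fs u ]%= suc)) ⟩
    map (_[ fs u ]%= suc) (tuples (suc n) k) ∎
  where
  open ≡-Reasoning
  lower : ∀ {i} → i ≤ k → filter (∁? (λ l → lookup l (fs u) ℕ.≟ 0)) (map (i ∷_) (tuples n (suc k ∸ i)))
                          ≡ map (i ∷_) (map (_[ u ]%= suc) (tuples n (k ∸ i)))
  lower {i} i≤k = begin
      filter (∁? (λ l → lookup l (fs u) ℕ.≟ 0)) (map (i ∷_) (tuples n (suc k ∸ i)))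
    ≡⟨ filter-map (∁? (λ l → lookup l (fs u) ℕ.≟ 0)) (i ∷_) (tuples n (suc k ∸ i)) ⟩
      map (i ∷_) (filter (∁? (λ l → lookup l u ℕ.≟ 0)) (tuples n (suc k ∸ i)))
    ≡⟨ cong (λ k' → map (i ∷_) (filter (∁? (λ l → lookup l u ℕ.≟ 0)) (tuples n k'))) (+-∸-assoc 1 i≤k) ⟩
      map (i ∷_) (filter (∁? (λ l → lookup l u ℕ.≟ 0)) (tuples n (suc (k ∸ i))))
    ≡⟨ cong (map (i ∷_)) (tuples-shift n (k ∸ i) u) ⟩
      map (i ∷_) (map (_[ u ]%= suc) (tuples n (k ∸ i))) ∎

%-+-congˡ : ∀ a b c m .{{_ : NonZero m}} → a % m ≡ b % m → (a + c) % m ≡ (b + c) % m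
%-+-congˡ a b c m a≡b = begin
  (a + c) % m           ≡⟨ %-distribˡ-+ a c m ⟩
  (a % m + c % m) % m   ≡⟨ cong (λ r → (r + c % m) % m) a≡b ⟩
  (b % m + c % m) % m   ≡⟨ %-distribˡ-+ b c m ⟨
  (b + c) % m           ∎
  where open ≡-Reasoning

-- Adding c * (m - 1) to both sides turns the common summand c into a multiple of m.
%-+-cancelʳ : ∀ a b c m .{{_ : NonZero m}} → (a + c) % m ≡ (b + c) % m → a % m ≡ b % m
%-+-cancelʳ a b c (suc m) a+c≡b+c = begin
  a % suc m                   ≡⟨ [m+kn]%n≡m%n a c (suc m) ⟨
  (a + c * suc m) % suc m     ≡⟨ %-congˡ (absorb a) ⟩
  (a + c + c * m) % suc m     ≡⟨ %-+-congˡ (a + c) (b + c) (c * m) (suc m) a+c≡b+c ⟩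
  (b + c + c * m) % suc m     ≡⟨ %-congˡ (absorb b) ⟨
  (b + c * suc m) % suc m     ≡⟨ [m+kn]%n≡m%n b c (suc m) ⟩
  b % suc m                   ∎
  where
  open ≡-Reasoning
  absorb : ∀ x → x + c * suc m ≡ x + c + c * m
  absorb x = trans (cong (x +_) (*-suc c m)) (sym (+-assoc x c (c * m)))

module _ {m : ℕ} .{{_ : NonZero m}} where

  toℕ-⊕ : (x y : Fin m) → toℕ (x ⊕ y) ≡ (toℕ x + toℕ y) % m
  toℕ-⊕ x y = toℕ-fromℕ< _

  toℕ-point : ∀ {n} (a : Fin m) (d : Fin n → Fin m) (l : Vec ℕ n) → toℕ (point a d l) ≡ (toℕ a + lin l d) % m
  toℕ-point a d l = toℕ-fromℕ< _

  toℕ%m : (x : Fin m) → toℕ x % m ≡ toℕ x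
  toℕ%m x = m<n⇒m%n≡m (toℕ<n x)

  ⊕-cancelʳ : ∀ {x y} (z : Fin m) → x ⊕ z ≡ y ⊕ z → x ≡ y
  ⊕-cancelʳ {x} {y} z x⊕z≡y⊕z = toℕ-injective (begin
    toℕ x       ≡⟨ toℕ%m x ⟨
    toℕ x % m   ≡⟨ %-+-cancelʳ (toℕ x) (toℕ y) (toℕ z) m
                     (trans (sym (toℕ-⊕ x z)) (trans (cong toℕ x⊕z≡y⊕z) (toℕ-⊕ y z))) ⟩
    toℕ y % m   ≡⟨ toℕ%m y ⟩
    toℕ y       ∎)
    where open ≡-Reasoning

⊕-identityʳ : ∀ {m} (x : Fin (suc m)) → x ⊕ fz ≡ x
⊕-identityʳ x = toℕ-injective (trans (toℕ-⊕ x fz) (trans (%-congˡ (+-identityʳ (toℕ x))) (toℕ%m x)))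

lin-update-suc : ∀ {n m} (u : Fin n) (l : Vec ℕ n) (d : Fin n → Fin m) →
  lin (l [ u ]%= suc) d ≡ lin l d + toℕ (d u)
lin-update-suc fz (x ∷ l) d = trans (+-assoc (toℕ (d fz)) _ _) (+-comm (toℕ (d fz)) _)
lin-update-suc (fs u) (x ∷ l) d =
  trans (cong (x * toℕ (d fz) +_) (lin-update-suc u l (d ∘ fs))) (sym (+-assoc (x * toℕ (d fz)) _ _))

point-update-suc : ∀ {n m} .{{_ : NonZero m}} (a : Fin m) (d : Fin n → Fin m) (u : Fin n) (l : Vec ℕ n) →
  point a d (l [ u ]%= suc) ≡ point a d l ⊕ d u
point-update-suc {m = m} a d u l = toℕ-injective (begin
  toℕ (point a d (l [ u ]%= suc))       ≡⟨ toℕ-point a d (l [ u ]%= suc) ⟩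
  (toℕ a + lin (l [ u ]%= suc) d) % m   ≡⟨ %-congˡ (cong (toℕ a +_) (lin-update-suc u l d)) ⟩
  (toℕ a + (lin l d + toℕ (d u))) % m   ≡⟨ %-congˡ (+-assoc (toℕ a) _ _) ⟨
  (toℕ a + lin l d + toℕ (d u)) % m     ≡⟨ %-+-congˡ _ _ (toℕ (d u)) m point%m ⟨
  (toℕ (point a d l) + toℕ (d u)) % m   ≡⟨ toℕ-⊕ (point a d l) (d u) ⟨
  toℕ (point a d l ⊕ d u)               ∎)
  where
  open ≡-Reasoning
  point%m : toℕ (point a d l) % m ≡ (toℕ a + lin l d) % m
  point%m = trans (toℕ%m (point a d l)) (toℕ-point a d l)

⊕-dExt-zero : ∀ {n m} .{{_ : NonZero m}} (d : Fin n → Fin m) (x : Fin m) → x ⊕ dExt d fz ≡ x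
⊕-dExt-zero {m = suc _} d x = ⊕-identityʳ x

dExt-suc : ∀ {n m} .{{_ : NonZero m}} (d : Fin n → Fin m) (u : Fin n) → dExt d (fs u) ≡ d u
dExt-suc {m = suc _} d u = refl

module _ {n m : ℕ} .{{_ : NonZero m}} (a : Fin m) (d : Fin n → Fin m) where

  multPoints : Fin m → List (Vec ℕ n) → ℕ
  multPoints y ls = length (filter (λ l → point a d l Fin.≟ y) ls)

  multPoints-shift : ∀ u y ls → multPoints (y ⊕ d u) (map (_[ u ]%= suc) ls) ≡ multPoints y ls
  multPoints-shift u y ls = begin
      length (filter (λ l → point a d l Fin.≟ y ⊕ d u) (map (_[ u ]%= suc) ls))
    ≡⟨ cong length (filter-map (λ l → point a d l Fin.≟ y ⊕ d u) (_[ u ]%= suc) ls) ⟩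
      length (map (_[ u ]%= suc) (filter (λ l → point a d (l [ u ]%= suc) Fin.≟ y ⊕ d u) ls))
    ≡⟨ length-map (_[ u ]%= suc) (filter (λ l → point a d (l [ u ]%= suc) Fin.≟ y ⊕ d u) ls) ⟩
      length (filter (λ l → point a d (l [ u ]%= suc) Fin.≟ y ⊕ d u) ls)
    ≡⟨ cong length (filter-≐ _ _ ((λ {l} → unshift l) , (λ {l} → shift l)) ls) ⟩
      multPoints y ls ∎
    where
    open ≡-Reasoning
    unshift : ∀ l → point a d (l [ u ]%= suc) ≡ y ⊕ d u → point a d l ≡ y
    unshift l e = ⊕-cancelʳ (d u) (trans (sym (point-update-suc a d u l)) e)
    shift : ∀ l → point a d l ≡ y → point a d (l [ u ]%= suc) ≡ y ⊕ d u
    shift l e = trans (point-update-suc a d u l) (cong (_⊕ d u) e)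

  offFacet : ℕ → Fin (suc n) → List (Vec ℕ n)
  offFacet s k = filter (∁? (facetCond? s k)) (tuples n (s ∸ 1))

  multAS-split : ∀ s k y → multAS a d s y ≡ multF k a d s y + multPoints y (offFacet s k)
  multAS-split s k y = length-filter-split (facetCond? s k) (λ l → point a d l Fin.≟ y) (tuples n (s ∸ 1))

  offFacet-empty : ∀ s k → s ∸ 1 ≡ 0 → offFacet s k ≡ []
  offFacet-empty s k s∸1≡0 = begin
    filter (∁? (facetCond? s k)) (tuples n (s ∸ 1))     ≡⟨ cong (filter (∁? (facetCond? s k)) ∘ tuples n) s∸1≡0 ⟩
    filter (∁? (facetCond? s k)) (tuples n 0)           ≡⟨ cong (filter (∁? (facetCond? s k))) (tuples-zero n) ⟩
    filter (∁? (facetCond? s k)) (replicate n 0 ∷ [])   ≡⟨ filter-reject (∁? (facetCond? s k)) (λ ¬onFacet → ¬onFacet (onFacet k)) ⟩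
    []                                                  ∎
    where
    open ≡-Reasoning
    onFacet : ∀ k → facetCond s k (replicate n 0)
    onFacet fz = trans (vsum-replicate-zero n) (sym s∸1≡0)
    onFacet (fs u) = lookup-replicate u 0

  offFacet-translate : ∀ x s k → multPoints (x ⊕ dExt d k) (offFacet s k) ≡ multPoints x (offFacet s fz)
  offFacet-translate x s fz = cong (λ y → multPoints y (offFacet s fz)) (⊕-dExt-zero d x)
  offFacet-translate x zero (fs u) =
    trans (cong (multPoints _) (offFacet-empty 0 (fs u) refl)) (cong (multPoints x) (sym (offFacet-empty 0 fz refl)))
  offFacet-translate x (suc zero) (fs u) =
    trans (cong (multPoints _) (offFacet-empty 1 (fs u) refl)) (cong (multPoints x) (sym (offFacet-empty 1 fz refl)))
  offFacet-translate x (suc (suc t)) (fs u) = begin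
    multPoints (x ⊕ dExt d (fs u)) (offFacet (suc (suc t)) (fs u))
      ≡⟨ cong₂ multPoints (cong (x ⊕_) (dExt-suc d u)) (tuples-shift n t u) ⟩
    multPoints (x ⊕ d u) (map (_[ u ]%= suc) (tuples n t))
      ≡⟨ multPoints-shift u x (tuples n t) ⟩
    multPoints x (tuples n t)
      ≡⟨ cong (multPoints x) (tuples-below n t) ⟨
    multPoints x (offFacet (suc (suc t)) fz) ∎
    where open ≡-Reasoning

  multAS≡multF+offFacet₀ : ∀ x s k →
    multAS a d s (x ⊕ dExt d k) ≡ multF k a d s (x ⊕ dExt d k) + multPoints x (offFacet s fz)
  multAS≡multF+offFacet₀ x s k =
    trans (multAS-split s k (x ⊕ dExt d k)) (cong (multF k a d s (x ⊕ dExt d k) +_) (offFacet-translate x s k))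

[p+r]-[q+r]≡p-q : ∀ (p q r : ℤ.ℤ) → (p ℤ.+ r) ℤ.- (q ℤ.+ r) ≡ p ℤ.- q
[p+r]-[q+r]≡p-q = solve-∀

-- The identity holds for all n, s and i, j.
lemma3p3 : (n m s : ℕ) → n ≥ 2 → .{{_ : NonZero m}} → s ≥ 1 →
    (a : Fin m) (d : Fin n → Fin m) (x : Fin m) (i j : Fin (suc n)) → i ≢ j →
    (ℤ.+ multAS a d s (x ⊕ dExt d j)) ℤ.- (ℤ.+ multAS a d s (x ⊕ dExt d i))
      ≡ (ℤ.+ multF j a d s (x ⊕ dExt d j)) ℤ.- (ℤ.+ multF i a d s (x ⊕ dExt d i))
lemma3p3 n m s _ _ a d x i j _
  rewrite multAS≡multF+offFacet₀ a d x s j | multAS≡multF+offFacet₀ a d x s i =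
  [p+r]-[q+r]≡p-q (ℤ.+ multF j a d s (x ⊕ dExt d j)) (ℤ.+ multF i a d s (x ⊕ dExt d i))
                  (ℤ.+ multPoints a d x (offFacet a d s fz))
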